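{- Let $G=(V,E)$ be a graph and let $D$ be an eternal dominating set of $G$ (in the one-guard-moves model). Suppose that, in some winning strategy for the defender starting from the guard configuration $D$, the guard on a vertex $v\in D$ may be moved to a vertex $u\in V-D$ (in response to an attack at $u$). Then $\operatorname{pn}(v,D)\cup\{u\}$ induces a clique in $G$.
   Context: Eternal domination game (one-guard-moves model): guards occupy the vertices of a set $D_1\subseteq V$, at most one guard per vertex. At each step the attacker chooses a vertex $r_i\notin D_i$, and the defender must move one guard from a vertex of $D_i$ adjacent to $r_i$ to $r_i$, producing $D_{i+1}=(D_i-\{w\})\cup\{r_i\}$; every configuration $D_i$ must be a dominating set of $G$. The defender wins if every (infinite) sequence of attacks can be defended in this way; a winning strategy is a rule for choosing the responding guard that achieves this. $D$ is an eternal dominating set if the defender has a winning strategy starting from $D$. For $v\in X\subseteq V$, the private neighbourhood of $v$ with respect to $X$ is $\operatorname{pn}(v,X)=N[v]-N[X-\{v\}]$, where $N[\cdot]$ denotes closed neighbourhood. -}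

module Defs where

open import Data.Nat using (ℕ)
open import Data.Fin using (Fin)
open import Data.Fin.Subset using (Subset; _∈_; _∉_; _∪_; _-_; ⁅_⁆)
open import Data.Product using (Σ; _×_)
open import Data.Sum using (_⊎_)
open import Relation.Nullary using (¬_)
open import Relation.Binary.PropositionalEquality using (_≡_; _≢_)

record Graph (n : ℕ) : Set₁ where
  field
    Adj    : Fin n → Fin n → Set
    sym    : ∀ {x y} → Adj x y → Adj y x
    irrefl : ∀ {x} → ¬ Adj x x
open Graph public

module _ {n : ℕ} (G : Graph n) where

  InClosedNbhd : Fin n → Fin n → Set
  InClosedNbhd w x = x ≡ w ⊎ Adj G w x

  Dominating : Subset n → Set
  Dominating S = ∀ x → Σ (Fin n) λ w → w ∈ S × InClosedNbhd w x

  InPrivNbhd : Fin n → Subset n → Fin n → Set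
  InPrivNbhd v X x =
    InClosedNbhd v x × (∀ w → w ∈ X → w ≢ v → ¬ InClosedNbhd w x)

  IsClique : (Fin n → Set) → Set
  IsClique P = ∀ x y → P x → P y → x ≢ y → Adj G x y

  move : Subset n → Fin n → Fin n → Subset n
  move S w r = (S - w) ∪ ⁅ r ⁆

  -- A (positional) winning strategy for the defender in the one-guard-moves
  -- eternal domination game: a family `Safe` of configurations that are all
  -- dominating, together with a rule `respond` which, for every configuration
  -- S in the family and every attack r ∉ S, chooses a guard w ∈ S adjacent
  -- to r such that the resulting configuration is again in the family.
  record WinningStrategy : Set₁ where
    field
      Safe     : Subset n → Set
      safe-dom : ∀ S → Safe S → Dominating S
      respond  : ∀ S → Safe S → ∀ r → r ∉ S →
                 Σ (Fin n) λ w → w ∈ S × Adj G w r × Safe (move S w r)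
  open WinningStrategy public

  EternalDominating : Subset n → Set₁
  EternalDominating D = Σ WinningStrategy λ σ → Safe σ D

{-# OPTIONS --safe #-}
module Submission where

-- Once the guard on v answers the attack at u, no guard of D − {v} is within reach of a
-- private neighbour x of v, so the guard now on u must dominate x.  If y is another private
-- neighbour, an attack at x must then be answered by that same guard, after which y is
-- dominated only by the guard on x; hence x and y are adjacent as well.

open import Defs
open import Data.Fin using (Fin; _≟_)
open import Data.Fin.Subset using (Subset; _∈_; _∉_; _⊆_; _─_; _-_; ⁅_⁆; inside; outside)
open import Data.Fin.Subset.Properties
  using (x∈p∪q⁻; x∈p∪q⁺; x∈⁅x⁆; x∈⁅y⁆⇒x≡y; x∉⁅y⁆⇒x≢y; x∈p∧x≢y⇒x∈p-y; p─q⊆p; ⊆-refl)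
open import Data.Nat using (ℕ)
open import Data.Product using (proj₁; proj₂; _×_; _,_)
open import Data.Sum using (_⊎_; inj₁; inj₂)
open import Data.Vec using (_∷_; here; there)
open import Function using (_∘_)
open import Relation.Nullary using (yes; no; contradiction)
open import Relation.Binary.PropositionalEquality using (_≡_; _≢_; refl; ≢-sym; subst)

private
  variable
    n : ℕ

x∈p─q⇒x∉q : ∀ {x : Fin n} (p q : Subset n) → x ∈ p ─ q → x ∉ q
x∈p─q⇒x∉q (inside ∷ p) (outside ∷ q) here ()
x∈p─q⇒x∉q (_ ∷ p) (_ ∷ q) (there x∈p─q) (there x∈q) = x∈p─q⇒x∉q p q x∈p─q x∈q

x∈p-y⇒x≢y : ∀ {x : Fin n} (p : Subset n) (y : Fin n) → x ∈ p - y → x ≢ y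
x∈p-y⇒x≢y p y = x∉⁅y⁆⇒x≢y ∘ x∈p─q⇒x∉q p ⁅ y ⁆

module _ (G : Graph n) where

  closedNbhd⇒adj : ∀ {w x} → InClosedNbhd G w x → x ≢ w → Adj G w x
  closedNbhd⇒adj (inj₁ x≡w) x≢w = contradiction x≡w x≢w
  closedNbhd⇒adj (inj₂ w~x) _   = w~x

  clique-insert : ∀ {P : Fin n → Set} u →
                  (∀ x → P x → x ≢ u → Adj G u x) →
                  (∀ x y → P x → P y → x ≢ u → y ≢ u → x ≢ y → Adj G x y) →
                  IsClique G (λ x → P x ⊎ x ≡ u)
  clique-insert {P = P} u hub rim = clique
    where
    member : ∀ {z} → P z ⊎ z ≡ u → z ≢ u → P z
    member (inj₁ Pz)  _   = Pz
    member (inj₂ z≡u) z≢u = contradiction z≡u z≢u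

    clique : IsClique G (λ x → P x ⊎ x ≡ u)
    clique x y x∈ y∈ x≢y with x ≟ u | y ≟ u
    ... | yes refl | _        = hub y (member y∈ (≢-sym x≢y)) (≢-sym x≢y)
    ... | no x≢u   | yes refl = Graph.sym G (hub x (member x∈ x≢u) x≢u)
    ... | no x≢u   | no y≢u   = rim x y (member x∈ x≢u) (member y∈ y≢u) x≢u y≢u x≢y

  ∈-move⁻ : ∀ {x} (S : Subset n) (w r : Fin n) →
            x ∈ move G S w r → (x ∈ S × x ≢ w) ⊎ x ≡ r
  ∈-move⁻ S w r x∈ with x∈p∪q⁻ (S - w) ⁅ r ⁆ x∈
  ... | inj₁ x∈S-w = inj₁ (p─q⊆p S ⁅ w ⁆ x∈S-w , x∈p-y⇒x≢y S w x∈S-w)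
  ... | inj₂ x∈⁅r⁆ = inj₂ (x∈⁅y⁆⇒x≡y r x∈⁅r⁆)

  ∈-move⁺ : ∀ {x} (S : Subset n) (w r : Fin n) →
            (x ∈ S × x ≢ w) ⊎ x ≡ r → x ∈ move G S w r
  ∈-move⁺ S w r (inj₁ (x∈S , x≢w)) = x∈p∪q⁺ (inj₁ (x∈p∧x≢y⇒x∈p-y x∈S x≢w))
  ∈-move⁺ S w r (inj₂ refl)        = x∈p∪q⁺ (inj₂ (x∈⁅x⁆ r))

  move-⊆-move : ∀ {S D : Subset n} {v u} (y : Fin n) →
                S ⊆ move G D v u → move G S u y ⊆ move G D v y
  move-⊆-move {S} {D} {v} {u} y S⊆ x∈ = ∈-move⁺ D v y (moved (∈-move⁻ S u y x∈))
    where
    moved : ∀ {x} → (x ∈ S × x ≢ u) ⊎ x ≡ y → (x ∈ D × x ≢ v) ⊎ x ≡ y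
    moved (inj₁ (x∈S , x≢u)) with ∈-move⁻ D v u (S⊆ x∈S)
    ... | inj₁ x∈D-v = inj₁ x∈D-v
    ... | inj₂ x≡u   = contradiction x≡u x≢u
    moved (inj₂ x≡y) = inj₂ x≡y

  module _ {D S : Subset n} {v r : Fin n} (S⊆ : S ⊆ move G D v r) where

    privateNbhd-guard≡ : ∀ {w x} → InPrivNbhd G v D x → w ∈ S → InClosedNbhd G w x → w ≡ r
    privateNbhd-guard≡ {w} (_ , apart) w∈S x∈N[w] with ∈-move⁻ D v r (S⊆ w∈S)
    ... | inj₁ (w∈D , w≢v) = contradiction x∈N[w] (apart w w∈D w≢v)
    ... | inj₂ w≡r         = w≡r

    privateNbhd-dominatedBy : ∀ {x} → Dominating G S → InPrivNbhd G v D x → InClosedNbhd G r x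
    privateNbhd-dominatedBy {x} S-dom x∈pn with S-dom x
    ... | w , w∈S , x∈N[w] with privateNbhd-guard≡ x∈pn w∈S x∈N[w]
    ...   | refl = x∈N[w]

    privateNbhd∉ : ∀ {x} → InPrivNbhd G v D x → x ≢ r → x ∉ S
    privateNbhd∉ {x} (_ , apart) x≢r x∈S with ∈-move⁻ D v r (S⊆ x∈S)
    ... | inj₁ (x∈D , x≢v) = apart x x∈D x≢v (inj₁ refl)
    ... | inj₂ x≡r         = x≢r x≡r

  privateNbhd-adj : ∀ (σ : WinningStrategy G) {D S : Subset n} {v r x y : Fin n} →
                    Safe σ S → S ⊆ move G D v r →
                    InPrivNbhd G v D x → InPrivNbhd G v D y → x ≢ r → y ≢ x → Adj G x y
  privateNbhd-adj σ {x = x} {y} S-safe S⊆ x∈pn y∈pn x≢r y≢x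
    with respond σ _ S-safe x (privateNbhd∉ S⊆ x∈pn x≢r)
  ... | w , w∈S , w~x , S′-safe with privateNbhd-guard≡ S⊆ x∈pn w∈S (inj₂ w~x)
  ...   | refl = closedNbhd⇒adj y∈N[x] y≢x
    where
    y∈N[x] : InClosedNbhd G x y
    y∈N[x] = privateNbhd-dominatedBy (move-⊆-move x S⊆) (safe-dom σ _ S′-safe) y∈pn

proposition1 : ∀ {n} (G : Graph n) (D : Subset n)
    (σ : WinningStrategy G) (hD : Safe σ D)
    (u v : Fin n) (hu : u ∉ D) →
    proj₁ (respond σ D hD u hu) ≡ v →
    IsClique G (λ x → InPrivNbhd G v D x ⊎ x ≡ u)
proposition1 G D σ hD u v hu v-answers = clique-insert G u hub rim
  where
  D′-safe : Safe σ (move G D v u)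
  D′-safe = subst (λ w → Safe σ (move G D w u)) v-answers
                  (proj₂ (proj₂ (proj₂ (respond σ D hD u hu))))

  hub : ∀ x → InPrivNbhd G v D x → x ≢ u → Adj G u x
  hub x x∈pn = closedNbhd⇒adj G
    (privateNbhd-dominatedBy G ⊆-refl (safe-dom σ _ D′-safe) x∈pn)

  rim : ∀ x y → InPrivNbhd G v D x → InPrivNbhd G v D y →
        x ≢ u → y ≢ u → x ≢ y → Adj G x y
  rim x y x∈pn y∈pn x≢u _ x≢y =
    privateNbhd-adj G σ D′-safe ⊆-refl x∈pn y∈pn x≢u (≢-sym x≢y)
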